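{- Let $M=\langle W,\mathcal{N},V\rangle$ be a gtn-model. Then $\mu=\{X\subseteq\bigcup\mathcal{N}: \text{for all } w\in X,\ X\in\mathcal{N}_w\}$ is a generalized topology on $W$. Equivalently, $\mu$ is a strong generalized topology on the universe $\bigcup\mathcal{N}$ (that is, it is moreover the case that $\bigcup\mathcal{N}\in\mu$).
   Context: A generalized topology on a nonempty set $U$ is a family $\mu\subseteq P(U)$ with $\emptyset\in\mu$ and closed under unions of arbitrary nonempty subfamilies; it is strong if $U\in\mu$. A gtn-model is $\langle W,\mathcal{N},V\rangle$ with $W$ nonempty, $V$ a map from propositional variables to $P(W)$ and $\mathcal{N}:W\to P(P(W))$ such that, writing $\bigcup\mathcal{N}$ for the union of all sets $X$ with $X\in\mathcal{N}_w$ for some $w\in W$: (1) $W=W_1\cup W_2$ where $W_1=\{z\in W: z\in\bigcap\mathcal{N}_z\}$ and $W_2=\{z\in W:z\notin\bigcup\mathcal{N}\}$, where $z\in\bigcap\mathcal{N}_z$ means that $\mathcal{N}_z\neq\emptyset$ and $z$ belongs to every member of $\mathcal{N}_z$; (2) if $X\in\mathcal{N}_w$ and $X\subseteq Y\subseteq\bigcup\mathcal{N}$ then $Y\in\mathcal{N}_w$; (3) if $X\in\mathcal{N}_w$ then $\{z\in W_1: X\in\mathcal{N}_z\}\in\mathcal{N}_w$. -}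

module Defs where

open import Level using (Level; _⊔_; suc; Lift)
open import Data.Nat using (ℕ)
open import Data.Empty using (⊥)
open import Data.Unit.Polymorphic using (⊤)
open import Data.Product using (Σ; ∃; _×_)
open import Data.Sum using (_⊎_)
open import Relation.Nullary using (¬_)
open import Relation.Unary using (Pred; _⊆_; _∈_)

_≐_ : ∀ {a ℓ₁ ℓ₂} {W : Set a} → Pred W ℓ₁ → Pred W ℓ₂ → Set (a ⊔ ℓ₁ ⊔ ℓ₂)
X ≐ Y = (X ⊆ Y) × (Y ⊆ X)

module _ {ℓ : Level} {W : Set ℓ} (N : W → Pred (Pred W ℓ) ℓ) where

  ⋃N : Pred W (suc ℓ)
  ⋃N z = Σ W λ w → Σ (Pred W ℓ) λ X → N w X × X z

  W₁ : Pred W (suc ℓ)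
  W₁ z = (Σ (Pred W ℓ) λ X → N z X) × (∀ X → N z X → X z)

  W₂ : Pred W (suc ℓ)
  W₂ z = ¬ ⋃N z

record GtnModel (ℓ : Level) : Set (suc ℓ) where
  field
    W : Set ℓ
    N : W → Pred (Pred W ℓ) ℓ
    V : ℕ → Pred W ℓ
    cond1 : ∀ z → W₁ N z ⊎ W₂ N z
    cond2 : ∀ w X Y → N w X → X ⊆ Y → Y ⊆ ⋃N N → N w Y
    -- (3) X ∈ N_w ⇒ {z ∈ W₁ : X ∈ N_z} ∈ N_w   (any level-ℓ subset Y
    --     extensionally equal to {z ∈ W₁ : X ∈ N_z} is required to be in N_w)
    cond3 : ∀ w X → N w X → ∀ (Y : Pred W ℓ) →
            Y ≐ (λ z → W₁ N z × N z X) → N w Y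

μ : ∀ {ℓ} (M : GtnModel ℓ) → Pred (Pred (GtnModel.W M) ℓ) (suc ℓ)
μ M X = (X ⊆ ⋃N N) × (∀ w → X w → N w X)
  where open GtnModel M

∅ : ∀ {ℓ} {W : Set ℓ} → Pred W ℓ
∅ _ = Lift _ ⊥

⋃ᶠ : ∀ {ℓ} {W : Set ℓ} {I : Set ℓ} → (I → Pred W ℓ) → Pred W ℓ
⋃ᶠ {I = I} F w = Σ I λ i → F i w

-- generalized topology  μ  on the universe  U  (U ⊆ W):
-- μ ⊆ P(U), ∅ ∈ μ, closed under unions of arbitrary nonempty subfamilies
IsGT : ∀ {ℓ ℓ' ℓ''} {W : Set ℓ} (U : Pred W ℓ') (m : Pred (Pred W ℓ) ℓ'') →
       Set (suc ℓ ⊔ ℓ' ⊔ ℓ'')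
IsGT {ℓ} {W = W} U m =
  (∀ X → m X → X ⊆ U) ×
  m ∅ ×
  (∀ (I : Set ℓ) (F : I → Pred W ℓ) → I → (∀ i → m (F i)) → m (⋃ᶠ F))

IsStrongGT : ∀ {ℓ ℓ''} {W : Set ℓ} (U : Pred W ℓ) (m : Pred (Pred W ℓ) ℓ'') →
             Set (suc ℓ ⊔ ℓ'')
IsStrongGT U m = IsGT U m × m U

Whole : ∀ {ℓ} {W : Set ℓ} → Pred W ℓ
Whole _ = ⊤

-- Every N_w is upward closed inside ⋃N (condition 2), so a union of open sets is a
-- neighbourhood of each of its points.  A point of ⋃N cannot lie in W₂, so by
-- condition (1) it lies in W₁ and has some neighbourhood, which enlarges to ⋃N.
module Submission where

open import Defs
open import Level using (Level; lift)
open import Data.Product using (Σ; _×_; _,_; proj₁; proj₂)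
open import Data.Sum using (inj₁; inj₂)
open import Data.Empty using (⊥-elim)
open import Relation.Unary using (Pred; _⊆_)

module _ {ℓ : Level} (M : GtnModel ℓ) where
  open GtnModel M

  μ⇒⊆⋃N : ∀ X → μ M X → X ⊆ ⋃N N
  μ⇒⊆⋃N _ = proj₁

  ∅∈μ : μ M ∅
  ∅∈μ = (λ { (lift ()) }) , (λ { w (lift ()) })

  ⋃ᶠ∈μ : ∀ (I : Set ℓ) (F : I → Pred W ℓ) → (∀ i → μ M (F i)) → μ M (⋃ᶠ F)
  ⋃ᶠ∈μ I F F∈μ = ⋃ᶠF⊆⋃N , ⋃ᶠF-open
    where
    ⋃ᶠF⊆⋃N : ⋃ᶠ F ⊆ ⋃N N
    ⋃ᶠF⊆⋃N (i , z∈Fi) = proj₁ (F∈μ i) z∈Fi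

    ⋃ᶠF-open : ∀ w → ⋃ᶠ F w → N w (⋃ᶠ F)
    ⋃ᶠF-open w (i , w∈Fi) =
      cond2 w (F i) (⋃ᶠ F) (proj₂ (F∈μ i) w w∈Fi) (i ,_) ⋃ᶠF⊆⋃N

  ⋃N⇒neighbourhood : ∀ {w} → ⋃N N w → Σ (Pred W ℓ) (N w)
  ⋃N⇒neighbourhood {w} w∈⋃N with cond1 w
  ... | inj₁ (X∈Nw , _) = X∈Nw
  ... | inj₂ w∉⋃N       = ⊥-elim (w∉⋃N w∈⋃N)

  ≐⋃N⇒∈μ : ∀ (U : Pred W ℓ) → U ≐ ⋃N N → μ M U
  ≐⋃N⇒∈μ U (U⊆⋃N , ⋃N⊆U) = U⊆⋃N , U-open
    where
    U-open : ∀ w → U w → N w U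
    U-open w w∈U with ⋃N⇒neighbourhood (U⊆⋃N w∈U)
    ... | X , X∈Nw = cond2 w X U X∈Nw (λ z∈X → ⋃N⊆U (w , X , X∈Nw , z∈X)) U⊆⋃N

  isGT-on : ∀ {ℓ'} (U : Pred W ℓ') → (∀ X → μ M X → X ⊆ U) → IsGT U (μ M)
  isGT-on U μ⊆U = μ⊆U , ∅∈μ , (λ I F _ → ⋃ᶠ∈μ I F)

mainTheorem4 : ∀ {ℓ : Level} (M : GtnModel ℓ) →
    IsGT Whole (μ M) ×
    (∀ (U : Pred (GtnModel.W M) ℓ) → U ≐ ⋃N (GtnModel.N M) → IsStrongGT U (μ M))
mainTheorem4 M =
  isGT-on M Whole (λ _ _ _ → _) ,
  λ U U≐⋃N@(_ , ⋃N⊆U) →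
    isGT-on M U (λ X X∈μ x∈X → ⋃N⊆U (μ⇒⊆⋃N M X X∈μ x∈X)) , ≐⋃N⇒∈μ M U U≐⋃N
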